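{- Let $k\ge 4$ and let $T$ be an $n$-vertex GDP-tree with maximum degree $\Delta(T)\le k-1$ that does not contain $K_k$ as a subgraph. Then $$2|E(T)|\le\left(k-2+\frac{2}{k-1}\right)n.$$
   Context: A GDP-tree is a (simple) graph in which every block is a complete graph or a cycle (of any length). $K_k$ is the complete graph on $k$ vertices. -}

module Defs where

open import Data.Nat using (ℕ; zero; suc; _+_; _≤_)
open import Data.Nat.Base using (_<ᵇ_)
open import Data.Bool using (Bool; true; false; T; _∧_; if_then_else_)
open import Data.Fin using (Fin; zero; suc; toℕ)
open import Data.Fin.Subset using (Subset; _∈_; _⊆_; Nonempty; ∣_∣; outside)
open import Data.Vec using (Vec; lookup; _[_]≔_)
open import Data.Product using (Σ; _×_)
open import Data.Sum using (_⊎_)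
open import Relation.Binary.PropositionalEquality using (_≡_; _≢_)
open import Function.Definitions using (Injective)

record Graph (n : ℕ) : Set where
  field
    adj    : Fin n → Fin n → Bool
    sym    : ∀ u v → adj u v ≡ adj v u
    irrefl : ∀ v → adj v v ≡ false
open Graph public

Adj : ∀ {n} → Graph n → Fin n → Fin n → Set
Adj G u v = T (adj G u v)

countF : ∀ {n} → (Fin n → Bool) → ℕ
countF {zero}  f = 0
countF {suc n} f = (if f zero then 1 else 0) + countF (λ i → f (suc i))

sumF : ∀ {n} → (Fin n → ℕ) → ℕ
sumF {zero}  f = 0
sumF {suc n} f = f zero + sumF (λ i → f (suc i))

deg : ∀ {n} → Graph n → Fin n → ℕ
deg G v = countF (adj G v)

degIn : ∀ {n} → Graph n → Subset n → Fin n → ℕ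
degIn G S v = countF (λ u → adj G v u ∧ lookup S u)

edgeCount : ∀ {n} → Graph n → ℕ
edgeCount G = sumF (λ u → countF (λ v → adj G u v ∧ (toℕ u <ᵇ toℕ v)))

data Walk {n} (G : Graph n) (S : Subset n) : Fin n → Fin n → Set where
  here : ∀ {v} → v ∈ S → Walk G S v v
  step : ∀ {u w v} → u ∈ S → Adj G u w → Walk G S w v → Walk G S u v

ConnectedIn : ∀ {n} → Graph n → Subset n → Set
ConnectedIn G S = ∀ u v → u ∈ S → v ∈ S → Walk G S u v

NoCutConnected : ∀ {n} → Graph n → Subset n → Set
NoCutConnected G S =
  Nonempty S × ConnectedIn G S × (∀ v → v ∈ S → ConnectedIn G (S [ v ]≔ outside))

IsBlock : ∀ {n} → Graph n → Subset n → Set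
IsBlock G S = NoCutConnected G S × (∀ S′ → S ⊆ S′ → NoCutConnected G S′ → S′ ⊆ S)

IsCompleteOn : ∀ {n} → Graph n → Subset n → Set
IsCompleteOn G S = ∀ u v → u ∈ S → v ∈ S → u ≢ v → Adj G u v

IsCycleOn : ∀ {n} → Graph n → Subset n → Set
IsCycleOn G S = (3 ≤ ∣ S ∣) × ConnectedIn G S × (∀ v → v ∈ S → degIn G S v ≡ 2)

IsGDPTree : ∀ {n} → Graph n → Set
IsGDPTree G = ∀ S → IsBlock G S → IsCompleteOn G S ⊎ IsCycleOn G S

ContainsK : ∀ {n} → ℕ → Graph n → Set
ContainsK {n} k G =
  Σ (Fin k → Fin n) (λ f → Injective _≡_ _≡_ f × (∀ i j → i ≢ j → Adj G (f i) (f j)))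

-- Put K = k − 1 and C = (k − 2)(k − 1) + 2, and call a vertex set U sparse when
-- 2|E(T[U])| · K ≤ C · |U|. Every U is sparse, by strong induction on |U|. A disconnected U
-- splits into two sparse parts with no edges between them. A connected U with at least two
-- vertices has an end block: a 2-connected set S = X ∪ {c} meeting the rest of U only at c.
-- In a GDP-tree S is a clique, with at most K vertices since K_k is excluded, or lies in a
-- cycle; either way 2|E(S)| is small enough that U is sparse as soon as U ∖ X is. The one
-- exception is an S of exactly K vertices whose root c already has K − 1 neighbours in S:
-- then c has at most one edge into U ∖ S, and that edge is paid for by the summand 2 in C
-- when one inducts on U ∖ S instead.

module Submission where

open import Defs hiding (sym)
open import Data.Nat using (ℕ; zero; suc; _+_; _*_; _∸_; _≤_; _<_; z≤n; s≤s; _≤?_; _<ᵇ_)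
open import Data.Nat.Properties hiding (_≟_)
open import Data.Nat.Induction using (<-wellFounded)
open import Induction.WellFounded using (WellFounded; Acc; acc; module All)
open import Level using (0ℓ)
import Relation.Binary.Construct.On as On
open import Algebra.Properties.Semiring.Sum +-*-semiring
  using (sum; sum-syntax; sum-replicate-zero; ∑-distrib-+; ∑-comm; *-distribˡ-sum; *-distribʳ-sum)
  renaming (sum-cong-≗ to ∑-cong)
open import Data.Bool using (Bool; true; false; T; _∧_; not; if_then_else_)
open import Data.Bool.Properties using (∧-identityʳ; ∧-zeroʳ; T-≡)
open import Data.Fin using (Fin; zero; suc; toℕ; _≟_)
open import Data.Fin.Properties using (any?; all?; ¬∀⟶∃¬; toℕ-injective)
import Data.Fin.Properties as Fin
open import Data.Fin.Subset using (Subset; _∈_; _∉_; _⊆_; _─_; Nonempty; inside; outside; ⊤)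
open import Data.Fin.Subset.Properties using (_∈?_; nonempty?; anySubset?; _⊆?_; p─q⊆p; x∈p∧x∉q⇒x∈p─q)
open import Data.Vec using (_∷_; here; there; lookup; _[_]≔_; tabulate)
open import Data.Vec.Properties
  using ([]=⇒lookup; lookup⇒[]=; lookup∘updateAt; lookup∘updateAt′; lookup∘tabulate; lookup-replicate)
open import Data.Product using (Σ; _×_; _,_; proj₁; proj₂)
open import Data.Sum using (_⊎_; inj₁; inj₂; [_,_]′)
open import Data.Empty using (⊥-elim)
open import Function using (_∘_; _on_; const)
open import Function.Definitions using (Injective)
open import Function.Bundles using (Equivalence)
open import Relation.Nullary using (¬_; Dec; yes; no; does; ofʸ; ofⁿ)
open import Relation.Nullary.Decidable using (_×-dec_; _→-dec_; T?; ¬?; dec-true; dec-false; decidable-stable)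
open import Relation.Binary.PropositionalEquality
  using (_≡_; _≢_; refl; sym; trans; cong; cong₂; subst; subst₂; module ≡-Reasoning)
open import Data.Nat.Solver using (module +-*-Solver)
open +-*-Solver using (solve; _:+_; _:*_; _:=_; con)

⟦_⟧ : Bool → ℕ
⟦ b ⟧ = if b then 1 else 0

T⇒≡true : ∀ {b} → T b → b ≡ true
T⇒≡true = Equivalence.to T-≡

≡true⇒T : ∀ {b} → b ≡ true → T b
≡true⇒T = Equivalence.from T-≡

does⇒witness : ∀ {p} {P : Set p} (P? : Dec P) → does P? ≡ true → P
does⇒witness (yes p) _ = p

⟦⟧≤1 : ∀ b → ⟦ b ⟧ ≤ 1
⟦⟧≤1 true  = s≤s z≤n
⟦⟧≤1 false = z≤n

⟦⟧-mono : ∀ {a b} → (a ≡ true → b ≡ true) → ⟦ a ⟧ ≤ ⟦ b ⟧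
⟦⟧-mono {false} _   = z≤n
⟦⟧-mono {true}  a⇒b rewrite a⇒b refl = s≤s z≤n

⟦∧⟧ : ∀ a b → ⟦ a ∧ b ⟧ ≡ ⟦ b ⟧ * ⟦ a ⟧
⟦∧⟧ true  true  = refl
⟦∧⟧ true  false = refl
⟦∧⟧ false true  = refl
⟦∧⟧ false false = refl

δ : ∀ {n} → Fin n → Fin n → ℕ
δ c i = ⟦ does (i ≟ c) ⟧

sumF≡∑ : ∀ {n} (f : Fin n → ℕ) → sumF f ≡ ∑[ i < n ] f i
sumF≡∑ {zero}  f = refl
sumF≡∑ {suc n} f = cong (f zero +_) (sumF≡∑ (f ∘ suc))

countF≡∑ : ∀ {n} (f : Fin n → Bool) → countF f ≡ ∑[ i < n ] ⟦ f i ⟧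
countF≡∑ {zero}  f = refl
countF≡∑ {suc n} f = cong (⟦ f zero ⟧ +_) (countF≡∑ (f ∘ suc))

∑-mono-≤ : ∀ {n} {f g : Fin n → ℕ} → (∀ i → f i ≤ g i) → sum f ≤ sum g
∑-mono-≤ {zero}  f≤g = z≤n
∑-mono-≤ {suc n} f≤g = +-mono-≤ (f≤g zero) (∑-mono-≤ (f≤g ∘ suc))

∑-zero : ∀ {n} {f : Fin n → ℕ} → (∀ i → f i ≡ 0) → sum f ≡ 0
∑-zero {n} f≗0 = trans (∑-cong f≗0) (sum-replicate-zero n)

∑-δ : ∀ {n} (c : Fin n) (h : Fin n → ℕ) → ∑[ i < n ] (δ c i * h i) ≡ h c
∑-δ zero    h = trans (cong₂ _+_ (+-identityʳ (h zero)) (∑-zero {f = λ i → δ zero (suc i) * h (suc i)} (λ _ → refl)))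
                      (+-identityʳ (h zero))
∑-δ (suc c) h = ∑-δ c (h ∘ suc)

∑∑ : ∀ {n} → (Fin n → Fin n → ℕ) → ℕ
∑∑ {n} h = ∑[ u < n ] ∑[ v < n ] h u v

∑∑-cong : ∀ {n} {h h′ : Fin n → Fin n → ℕ} → (∀ u v → h u v ≡ h′ u v) → ∑∑ h ≡ ∑∑ h′
∑∑-cong h≗h′ = ∑-cong λ u → ∑-cong (h≗h′ u)

∑∑-distrib-+ : ∀ {n} (h h′ : Fin n → Fin n → ℕ) → ∑∑ (λ u v → h u v + h′ u v) ≡ ∑∑ h + ∑∑ h′
∑∑-distrib-+ h h′ = trans (∑-cong λ u → ∑-distrib-+ (h u) (h′ u)) (∑-distrib-+ (λ u → sum (h u)) (λ u → sum (h′ u)))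

∑∑-zero : ∀ {n} {h : Fin n → Fin n → ℕ} → (∀ u v → h u v ≡ 0) → ∑∑ h ≡ 0
∑∑-zero h≗0 = ∑-zero λ u → ∑-zero (h≗0 u)

∑-one : ∀ n → ∑[ i < n ] 1 ≡ n
∑-one zero    = refl
∑-one (suc n) = cong suc (∑-one n)

infix 4 _⊆ᵇ_
_⊆ᵇ_ : ∀ {n} → (Fin n → Bool) → (Fin n → Bool) → Set
f ⊆ᵇ g = ∀ i → f i ≡ true → g i ≡ true

countF-≤ : ∀ {n} (f : Fin n → Bool) → countF f ≤ n
countF-≤ {zero}  f = z≤n
countF-≤ {suc n} f = +-mono-≤ (⟦⟧≤1 (f zero)) (countF-≤ (f ∘ suc))

countF-mono : ∀ {n} {f g : Fin n → Bool} → f ⊆ᵇ g → countF f ≤ countF g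
countF-mono {zero}  f⊆g = z≤n
countF-mono {suc n} f⊆g = +-mono-≤ (⟦⟧-mono (f⊆g zero)) (countF-mono (f⊆g ∘ suc))

countF-< : ∀ {n} {f g : Fin n → Bool} → f ⊆ᵇ g →
           ∀ a → g a ≡ true → f a ≡ false → countF f < countF g
countF-< {suc n} {f} {g} f⊆g zero ga fa rewrite ga | fa = s≤s (countF-mono (f⊆g ∘ suc))
countF-< {suc n} {f} {g} f⊆g (suc a) ga fa =
  subst (_≤ ⟦ g zero ⟧ + countF (g ∘ suc)) (+-suc ⟦ f zero ⟧ _)
    (+-mono-≤ (⟦⟧-mono (f⊆g zero)) (countF-< (f⊆g ∘ suc) a ga fa))

countF-≤-suc : ∀ {n} {f g : Fin n → Bool} (a : Fin n) →
               (∀ i → i ≢ a → g i ≡ true → f i ≡ true) → countF g ≤ suc (countF f)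
countF-≤-suc {suc n} {f} {g} zero g⊆f = +-mono-≤ (⟦⟧≤1 (g zero))
  (≤-trans (countF-mono (λ i → g⊆f (suc i) λ ())) (m≤n+m _ ⟦ f zero ⟧))
countF-≤-suc {suc n} {f} {g} (suc a) g⊆f =
  subst (countF g ≤_) (+-suc ⟦ f zero ⟧ _)
    (+-mono-≤ (⟦⟧-mono (g⊆f zero λ ())) (countF-≤-suc a λ i i≢a → g⊆f (suc i) (i≢a ∘ Fin.suc-injective)))

countF-false : ∀ {n} → countF {n} (λ _ → false) ≡ 0
countF-false {zero}  = refl
countF-false {suc n} = countF-false {n}

countF-pos : ∀ {n} {f : Fin n → Bool} (a : Fin n) → f a ≡ true → 0 < countF f
countF-pos {n} {f} a fa = subst (_< countF f) (countF-false {n}) (countF-< {f = λ _ → false} (λ _ ()) a fa refl)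

countF-≥2 : ∀ {n} {f : Fin n → Bool} {a b : Fin n} →
            f a ≡ true → f b ≡ true → a ≢ b → 2 ≤ countF f
countF-≥2 {f = f} {a} {b} fa fb a≢b =
  ≤-trans (s≤s (countF-pos a (dec-true (a ≟ a) refl))) (countF-< is-a⊆f b fb (dec-false (b ≟ a) (a≢b ∘ sym)))
  where
  is-a⊆f : (λ i → does (i ≟ a)) ⊆ᵇ f
  is-a⊆f i eq = subst (λ j → f j ≡ true) (sym (does⇒witness (i ≟ a) eq)) fa

countF-injection : ∀ {n} k (f : Fin n → Bool) → k ≤ countF f →
                   Σ (Fin k → Fin n) λ g → Injective _≡_ _≡_ g × (∀ i → f (g i) ≡ true)
countF-injection zero    f _ = (λ ()) , (λ { {()} }) , (λ ())
countF-injection {suc n} (suc k) f k<count with f zero in f0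
... | false = let (g , g-inj , g-ok) = countF-injection (suc k) (f ∘ suc) k<count in
              suc ∘ g , g-inj ∘ Fin.suc-injective , g-ok
... | true  = let (g , g-inj , g-ok) = countF-injection k (f ∘ suc) (≤-pred k<count) in
              cons g , cons-inj g-inj , cons-ok g-ok
  where
  cons : (Fin k → Fin n) → Fin (suc k) → Fin (suc n)
  cons g zero    = zero
  cons g (suc i) = suc (g i)
  cons-inj : ∀ {g} → Injective _≡_ _≡_ g → Injective _≡_ _≡_ (cons g)
  cons-inj g-inj {zero}  {zero}  _  = refl
  cons-inj g-inj {suc i} {suc j} eq = cong suc (g-inj (Fin.suc-injective eq))
  cons-ok : ∀ {g} → (∀ i → f (suc (g i)) ≡ true) → ∀ i → f (cons g i) ≡ true
  cons-ok g-ok zero    = f0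
  cons-ok g-ok (suc i) = g-ok i

counterexample : ∀ {n p q} {P : Fin n → Set p} {Q : Fin n → Set q} →
                 (∀ x → Dec (P x)) → (∀ x → Dec (Q x)) → ¬ (∀ x → P x → Q x) → Σ (Fin n) λ x → P x × ¬ Q x
counterexample {n} P? Q? ¬∀ with ¬∀⟶∃¬ n _ (λ x → P? x →-dec Q? x) ¬∀
... | x , ¬P⇒Q with P? x
...   | yes Px = x , Px , λ Qx → ¬P⇒Q λ _ → Qx
...   | no ¬Px = ⊥-elim (¬P⇒Q λ Px → ⊥-elim (¬Px Px))

x∈p─q⇒x∉q : ∀ {n} (p q : Subset n) {x} → x ∈ p ─ q → x ∉ q
x∈p─q⇒x∉q (_ ∷ p) (_ ∷ q) (there x∈p─q) (there x∈q) = x∈p─q⇒x∉q p q x∈p─q x∈q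

module _ {n : ℕ} where

  ∈⇒lookup : ∀ {x} {S : Subset n} → x ∈ S → lookup S x ≡ true
  ∈⇒lookup = []=⇒lookup

  lookup⇒∈ : ∀ {x} {S : Subset n} → lookup S x ≡ true → x ∈ S
  lookup⇒∈ {x} {S} = lookup⇒[]= x S

  ∉⇒lookup : ∀ {x} {S : Subset n} → x ∉ S → lookup S x ≡ false
  ∉⇒lookup {x} {S} x∉S with lookup S x in eq
  ... | true  = ⊥-elim (x∉S (lookup⇒∈ eq))
  ... | false = refl

  lookup⇒∉ : ∀ {x} {S : Subset n} → lookup S x ≡ false → x ∉ S
  lookup⇒∉ x∉S x∈S with () ← trans (sym x∉S) (∈⇒lookup x∈S)

  ∈-delete⁺ : ∀ {S : Subset n} {v x} → x ∈ S → x ≢ v → x ∈ S [ v ]≔ outside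
  ∈-delete⁺ {S} {v} {x} x∈S x≢v = lookup⇒∈ (trans (lookup∘updateAt′ x v x≢v S) (∈⇒lookup x∈S))

  ∈-delete⁻ : ∀ {S : Subset n} {v x} → x ∈ S [ v ]≔ outside → x ∈ S × x ≢ v
  ∈-delete⁻ {S} {v} {x} x∈S-v with x ≟ v
  ... | yes refl = ⊥-elim (lookup⇒∉ (lookup∘updateAt v S) x∈S-v)
  ... | no x≢v   = lookup⇒∈ (trans (sym (lookup∘updateAt′ x v x≢v S)) (∈⇒lookup x∈S-v)) , x≢v

  ∈-insert-here : ∀ (X : Subset n) c → c ∈ X [ c ]≔ inside
  ∈-insert-here X c = lookup⇒∈ (lookup∘updateAt c X)

  ∈-insert⁺ : ∀ {X : Subset n} {c x} → x ∈ X → x ∈ X [ c ]≔ inside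
  ∈-insert⁺ {X} {c} {x} x∈X with x ≟ c
  ... | yes refl = ∈-insert-here X c
  ... | no x≢c   = lookup⇒∈ (trans (lookup∘updateAt′ x c x≢c X) (∈⇒lookup x∈X))

  ∈-insert⁻′ : ∀ {X : Subset n} {c x} → x ∈ X [ c ]≔ inside → x ≢ c → x ∈ X
  ∈-insert⁻′ {X} {c} {x} x∈X+c x≢c = lookup⇒∈ (trans (sym (lookup∘updateAt′ x c x≢c X)) (∈⇒lookup x∈X+c))

  ∈-insert⁻ : ∀ {X : Subset n} {c x} → x ∈ X [ c ]≔ inside → x ≡ c ⊎ x ∈ X
  ∈-insert⁻ {X} {c} {x} x∈X+c with x ≟ c
  ... | yes x≡c = inj₁ x≡c
  ... | no x≢c  = inj₂ (∈-insert⁻′ x∈X+c x≢c)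

  card : Subset n → ℕ
  card S = countF (lookup S)

  card-< : ∀ {S U : Subset n} {u} → S ⊆ U → u ∈ U → u ∉ S → card S < card U
  card-< {S} {U} {u} S⊆U u∈U u∉S =
    countF-< (λ i → ∈⇒lookup ∘ S⊆U ∘ lookup⇒∈) u (∈⇒lookup {S = U} u∈U) (∉⇒lookup {S = S} u∉S)

  card-pos : ∀ {S : Subset n} {x} → x ∈ S → 0 < card S
  card-pos {S} {x} x∈S = countF-pos x (∈⇒lookup {S = S} x∈S)

  infix 4 _⊏_
  _⊏_ : Subset n → Subset n → Set
  _⊏_ = _<_ on card

  ⊏-wellFounded : WellFounded _⊏_
  ⊏-wellFounded = On.wellFounded card <-wellFounded

module Walks {n : ℕ} (G : Graph n) where

  Adj-sym : ∀ {u v} → Adj G u v → Adj G v u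
  Adj-sym {u} {v} = subst T (Graph.sym G u v)

  Adj⇒≢ : ∀ {u v} → Adj G u v → u ≢ v
  Adj⇒≢ {u} a refl = subst T (Graph.irrefl G u) a

  source∈ : ∀ {S u v} → Walk G S u v → u ∈ S
  source∈ (here u∈S)     = u∈S
  source∈ (step u∈S _ _) = u∈S

  _▷_ : ∀ {S u w v} → Walk G S u w → Adj G w v × v ∈ S → Walk G S u v
  here w∈S     ▷ (a , v∈S) = step w∈S a (here v∈S)
  step p b wlk ▷ last      = step p b (wlk ▷ last)

  _++ᵂ_ : ∀ {S u w v} → Walk G S u w → Walk G S w v → Walk G S u v
  here _       ++ᵂ wlk′ = wlk′
  step p b wlk ++ᵂ wlk′ = step p b (wlk ++ᵂ wlk′)

  reverse : ∀ {S u v} → Walk G S u v → Walk G S v u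
  reverse (here p)       = here p
  reverse (step p a wlk) = reverse wlk ▷ (Adj-sym a , p)

  widen : ∀ {S S′ : Subset n} → S ⊆ S′ → ∀ {u v} → Walk G S u v → Walk G S′ u v
  widen S⊆S′ (here p)       = here (S⊆S′ p)
  widen S⊆S′ (step p a wlk) = step (S⊆S′ p) a (widen S⊆S′ wlk)

  transport : ∀ {S : Subset n} (P : Fin n → Set) → (∀ {y v} → P y → v ∈ S → Adj G y v → P v) →
              ∀ {u v} → Walk G S u v → P u → P v
  transport P closed (here _)       Pu = Pu
  transport P closed (step _ a wlk) Pu = transport P closed wlk (closed Pu (source∈ wlk) a)

  first-step : ∀ {S u v} → Walk G S u v → u ≢ v → Σ (Fin n) λ w → Adj G u w × w ∈ S
  first-step (here _)       u≢v = ⊥-elim (u≢v refl)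
  first-step (step _ a wlk) _   = _ , a , source∈ wlk

  avoid : ∀ {S : Subset n} u {w v} → Walk G S w v → v ≢ u →
          Walk G (S [ u ]≔ outside) w v ⊎ Σ (Fin n) λ w′ → Adj G u w′ × Walk G (S [ u ]≔ outside) w′ v
  avoid u (here p) v≢u = inj₁ (here (∈-delete⁺ p v≢u))
  avoid u (step {u = w} {w = w₂} p a rest) v≢u with avoid u rest v≢u
  ... | inj₂ tail = inj₂ tail
  ... | inj₁ rest′ with w ≟ u
  ...   | yes refl = inj₂ (w₂ , a , rest′)
  ...   | no w≢u   = inj₁ (step (∈-delete⁺ p w≢u) a rest′)

  walk? : ∀ (S : Subset n) u v → Dec (Walk G S u v)
  walk? S = go n S (countF-≤ (lookup S))
    where
    go : ∀ fuel (S : Subset n) → card S ≤ fuel → ∀ u v → Dec (Walk G S u v)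
    go fuel S _ u v with u ∈? S
    ... | no u∉S = no (u∉S ∘ source∈)
    ... | yes u∈S with u ≟ v
    ...   | yes refl = yes (here u∈S)
    go zero S S≤0 u v | yes u∈S | no _ = ⊥-elim (<⇒≱ (card-pos u∈S) S≤0)
    go (suc fuel) S S≤fuel u v | yes u∈S | no u≢v
      with any? (λ w → T? (adj G u w) ×-dec go fuel (S [ u ]≔ outside) S-u≤fuel w v)
      where
      S-u≤fuel : card (S [ u ]≔ outside) ≤ fuel
      S-u≤fuel = ≤-pred (≤-trans (card-< (proj₁ ∘ ∈-delete⁻) u∈S (λ u∈S-u → proj₂ (∈-delete⁻ u∈S-u) refl)) S≤fuel)
    ... | yes (w , a , wlk) = yes (step u∈S a (widen (proj₁ ∘ ∈-delete⁻) wlk))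
    ... | no ¬step = no λ wlk →
      [ (λ wlk′ → proj₂ (∈-delete⁻ (source∈ wlk′)) refl) , ¬step ]′ (avoid u wlk (u≢v ∘ sym))

  connected? : ∀ (S : Subset n) → Dec (ConnectedIn G S)
  connected? S = all? λ u → all? λ v → (u ∈? S) →-dec ((v ∈? S) →-dec walk? S u v)

  noCutConnected? : ∀ (S : Subset n) → Dec (NoCutConnected G S)
  noCutConnected? S = nonempty? S ×-dec connected? S ×-dec all? (λ v → (v ∈? S) →-dec connected? (S [ v ]≔ outside))

  disconnected : ∀ W → ¬ ConnectedIn G W → Σ (Fin n) λ u → Σ (Fin n) λ w → u ∈ W × w ∈ W × ¬ Walk G W u w
  disconnected W ¬conn =
    let (u , u∈W , ¬from-u) = counterexample (_∈? W) (λ u → all? λ v → (v ∈? W) →-dec walk? W u v)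
                                (λ conn → ¬conn λ u v u∈W v∈W → conn u u∈W v v∈W)
        (w , w∈W , ¬u-w)    = counterexample (_∈? W) (walk? W u) ¬from-u
    in u , w , u∈W , w∈W , ¬u-w

  unreachable : Subset n → Fin n → Subset n
  unreachable W b = tabulate λ x → lookup W x ∧ not (does (walk? W b x))

  ∈-unreachable⁻ : ∀ W b {x} → x ∈ unreachable W b → x ∈ W × ¬ Walk G W b x
  ∈-unreachable⁻ W b {x} x∈ = from (trans (sym (lookup∘tabulate _ x)) (∈⇒lookup x∈))
    where
    from : lookup W x ∧ not (does (walk? W b x)) ≡ true → x ∈ W × ¬ Walk G W b x
    from eq with lookup W x in x∈W | walk? W b x
    ... | true | no ¬wlk = lookup⇒∈ x∈W , ¬wlk

  ∈-unreachable⁺ : ∀ W b {x} → x ∈ W → ¬ Walk G W b x → x ∈ unreachable W b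
  ∈-unreachable⁺ W b {x} x∈W ¬wlk = lookup⇒∈ (trans (lookup∘tabulate _ x) to)
    where
    to : lookup W x ∧ not (does (walk? W b x)) ≡ true
    to with walk? W b x
    ... | yes wlk = ⊥-elim (¬wlk wlk)
    ... | no _ rewrite ∈⇒lookup x∈W = refl

  unreachable-closed : ∀ W b {y v} → y ∈ unreachable W b → v ∈ W → Adj G y v → v ∈ unreachable W b
  unreachable-closed W b {y} {v} y∈ v∈W a with walk? W b v
  ... | yes wlk = let (y∈W , ¬b-y) = ∈-unreachable⁻ W b y∈ in ⊥-elim (¬b-y (wlk ▷ (Adj-sym a , y∈W)))
  ... | no ¬wlk = ∈-unreachable⁺ W b v∈W ¬wlk

module Blocks {n : ℕ} (G : Graph n) where
  open Walks G

  block-containing : ∀ fuel S → n ≤ card S + fuel → NoCutConnected G S →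
                     Σ (Subset n) λ B → S ⊆ B × IsBlock G B
  block-containing fuel S bound ncc
    with anySubset? {P = λ S′ → S ⊆ S′ × NoCutConnected G S′ × ¬ (S′ ⊆ S)}
           (λ S′ → (S ⊆? S′) ×-dec noCutConnected? S′ ×-dec ¬? (S′ ⊆? S))
  ... | no ¬larger = S , (λ x∈S → x∈S) , ncc , maximal
    where
    maximal : ∀ S′ → S ⊆ S′ → NoCutConnected G S′ → S′ ⊆ S
    maximal S′ S⊆S′ ncc′ with S′ ⊆? S
    ... | yes S′⊆S = S′⊆S
    ... | no S′⊈S  = ⊥-elim (¬larger (S′ , S⊆S′ , ncc′ , S′⊈S))
  ... | yes (S′ , S⊆S′ , ncc′ , S′⊈S) with counterexample (_∈? S′) (_∈? S) (λ S′⊆S → S′⊈S (S′⊆S _)) | fuel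
  ...   | x , x∈S′ , x∉S | zero =
    ⊥-elim (<⇒≱ (≤-trans (card-< S⊆S′ x∈S′ x∉S) (countF-≤ (lookup S′))) (subst (n ≤_) (+-identityʳ _) bound))
  ...   | x , x∈S′ , x∉S | suc fuel′ =
    let S′-bound = ≤-trans bound (subst (_≤ card S′ + fuel′) (sym (+-suc (card S) fuel′))
                                        (+-monoˡ-≤ fuel′ (card-< S⊆S′ x∈S′ x∉S)))
        (B , S′⊆B , block) = block-containing fuel′ S′ S′-bound ncc′
    in B , S′⊆B ∘ S⊆S′ , block

  gdp-shape : IsGDPTree G → ∀ S → NoCutConnected G S →
              IsCompleteOn G S ⊎ Σ (Subset n) (λ B → S ⊆ B × IsCycleOn G B)
  gdp-shape gdp S ncc with block-containing n S (m≤n+m n (card S)) ncc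
  ... | B , S⊆B , block with gdp B block
  ...   | inj₁ complete = inj₁ λ u v u∈S v∈S u≢v → complete u v (S⊆B u∈S) (S⊆B v∈S) u≢v
  ...   | inj₂ cycle    = inj₂ (B , S⊆B , cycle)

module Degrees {n : ℕ} (G : Graph n) where
  open Walks G

  neighboursIn : Subset n → Fin n → Fin n → Bool
  neighboursIn S x v = adj G x v ∧ lookup S v

  ∈-neighbours⁺ : ∀ {S : Subset n} {x v} → Adj G x v → v ∈ S → neighboursIn S x v ≡ true
  ∈-neighbours⁺ {S} {x} {v} a v∈S rewrite ∈⇒lookup v∈S | T⇒≡true a = refl

  ∈-neighbours⁻ : ∀ {S : Subset n} {x v} → neighboursIn S x v ≡ true → Adj G x v × v ∈ S
  ∈-neighbours⁻ {S} {x} {v} eq with adj G x v | lookup S v in v∈S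
  ... | true | true = _ , lookup⇒∈ v∈S

  degIn-≤-deg : ∀ S x → degIn G S x ≤ deg G x
  degIn-≤-deg S x = countF-mono {f = neighboursIn S x} λ v eq → T⇒≡true (proj₁ (∈-neighbours⁻ {S} eq))

  degIn-mono : ∀ {S S′ : Subset n} → S ⊆ S′ → ∀ x → degIn G S x ≤ degIn G S′ x
  degIn-mono {S} {S′} S⊆S′ x = countF-mono {f = neighboursIn S x} λ v eq →
    let (a , v∈S) = ∈-neighbours⁻ {S} eq in ∈-neighbours⁺ {S′} a (S⊆S′ v∈S)

  degIn-< : ∀ {S x} → x ∈ S → degIn G S x < card S
  degIn-< {S} {x} x∈S =
    countF-< {f = neighboursIn S x} (λ v eq → ∈⇒lookup (proj₂ (∈-neighbours⁻ {S} eq))) x (∈⇒lookup x∈S)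
      (subst (λ b → b ∧ lookup S x ≡ false) (sym (Graph.irrefl G x)) refl)

  card-≤-suc-degIn : ∀ {S x} → IsCompleteOn G S → x ∈ S → card S ≤ suc (degIn G S x)
  card-≤-suc-degIn {S} {x} complete x∈S = countF-≤-suc {f = neighboursIn S x} x λ v v≢x v∈S →
    ∈-neighbours⁺ {S} (complete x v x∈S (lookup⇒∈ v∈S) (v≢x ∘ sym)) (lookup⇒∈ v∈S)

  degIn-cycle : ∀ {S B x} → S ⊆ B → IsCycleOn G B → x ∈ S → degIn G S x ≤ 2
  degIn-cycle {x = x} S⊆B (_ , _ , 2-regular) x∈S =
    ≤-trans (degIn-mono S⊆B x) (≤-reflexive (2-regular x (S⊆B x∈S)))

  clique-card : ∀ {k} → ¬ ContainsK k G → ∀ {S} → IsCompleteOn G S → card S < k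
  clique-card {k} noK {S} complete with k ≤? card S
  ... | no k≰S = ≰⇒> k≰S
  ... | yes k≤S =
    let (f , f-inj , f∈S) = countF-injection k (lookup S) k≤S in
    ⊥-elim (noK (f , f-inj , λ i j i≢j → complete (f i) (f j) (lookup⇒∈ (f∈S i)) (lookup⇒∈ (f∈S j)) (i≢j ∘ f-inj)))

  third-vertex : ∀ {S} a b → 3 ≤ card S → Σ (Fin n) λ t → t ∈ S × t ≢ a × t ≢ b
  third-vertex {S} a b 3≤S with any? (λ t → (t ∈? S) ×-dec ¬? (t ≟ a) ×-dec ¬? (t ≟ b))
  ... | yes found = found
  ... | no ¬found = ⊥-elim (<⇒≱ 3≤S (≤-trans S⊆a+b (s≤s b≤1)))
    where
    is-b : Fin n → Bool
    is-b i = does (i ≟ b)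
    S⊆a+b : card S ≤ suc (countF is-b)
    S⊆a+b = countF-≤-suc a λ i i≢a i∈S →
      dec-true (i ≟ b) (decidable-stable (i ≟ b) λ i≢b → ¬found (i , lookup⇒∈ i∈S , i≢a , i≢b))
    b≤1 : countF is-b ≤ 1
    b≤1 = subst (λ m → countF is-b ≤ suc m) (countF-false {n})
      (countF-≤-suc {f = λ _ → false} b λ i i≢b eq → ⊥-elim (i≢b (does⇒witness (i ≟ b) eq)))

  -- c has a neighbour w, and, w not being a cut vertex, a second neighbour in S − w.
  noCut-degIn-≥2 : ∀ {S c} → NoCutConnected G S → 3 ≤ card S → c ∈ S → 2 ≤ degIn G S c
  noCut-degIn-≥2 {S} {c} (_ , conn , noCut) 3≤S c∈S =
    let (t , t∈S , t≢c , _)     = third-vertex c c 3≤S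
        (w , c~w , w∈S)         = first-step (conn c t c∈S t∈S) (t≢c ∘ sym)
        (t′ , t′∈S , t′≢c , t′≢w) = third-vertex c w 3≤S
        (w′ , c~w′ , w′∈S-w)    = first-step (noCut w w∈S c t′ (∈-delete⁺ c∈S (Adj⇒≢ c~w)) (∈-delete⁺ t′∈S t′≢w))
                                             (t′≢c ∘ sym)
        (w′∈S , w′≢w)           = ∈-delete⁻ w′∈S-w
    in countF-≥2 (∈-neighbours⁺ {S} c~w w∈S) (∈-neighbours⁺ {S} c~w′ w′∈S) (w′≢w ∘ sym)

module Branches {n : ℕ} (G : Graph n) where
  open Walks G

  -- X is a union of components of U − c, and c is where it is attached.
  record Branch (U : Subset n) (c : Fin n) (X : Subset n) : Set where
    field
      root∈U   : c ∈ U
      X⊆U      : X ⊆ U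
      root∉X   : c ∉ X
      nonempty : Nonempty X
      closed   : ∀ {x v} → x ∈ X → v ∈ U → Adj G x v → v ∈ X ⊎ v ≡ c

    rooted⊆U : X [ c ]≔ inside ⊆ U
    rooted⊆U x∈ = [ (λ { refl → root∈U }) , X⊆U ]′ (∈-insert⁻ x∈)

    closed-rooted : ∀ {x v} → x ∈ X → v ∈ U → Adj G x v → v ∈ X [ c ]≔ inside
    closed-rooted x∈X v∈U a = [ ∈-insert⁺ , (λ { refl → ∈-insert-here X c }) ]′ (closed x∈X v∈U a)

  open Branch

  complement-branch : ∀ {U c x} → c ∈ U → x ∈ U → x ≢ c → Branch U c (U [ c ]≔ outside)
  complement-branch {U} {c} {x} c∈U x∈U x≢c = record
    { root∈U   = c∈U
    ; X⊆U      = proj₁ ∘ ∈-delete⁻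
    ; root∉X   = λ c∈ → proj₂ (∈-delete⁻ c∈) refl
    ; nonempty = x , ∈-delete⁺ x∈U x≢c
    ; closed   = λ {_} {v} _ v∈U _ → closed′ v v∈U
    }
    where
    closed′ : ∀ v → v ∈ U → v ∈ U [ c ]≔ outside ⊎ v ≡ c
    closed′ v v∈U with v ≟ c
    ... | yes v≡c = inj₂ v≡c
    ... | no v≢c  = inj₁ (∈-delete⁺ v∈U v≢c)

  sub-branch : ∀ {U c X v b} → Branch U c X → v ∈ X [ c ]≔ inside →
               let Y = unreachable ((X [ c ]≔ inside) [ v ]≔ outside) b in
               Nonempty Y → Y ⊆ X → Branch U v Y
  sub-branch {U} {c} {X} {v} {b} br v∈S Y≠∅ Y⊆X = record
    { root∈U   = rooted⊆U br v∈S
    ; X⊆U      = X⊆U br ∘ Y⊆X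
    ; root∉X   = λ v∈Y → proj₂ (∈-delete⁻ (proj₁ (∈-unreachable⁻ W b v∈Y))) refl
    ; nonempty = Y≠∅
    ; closed   = closed′
    }
    where
    W : Subset n
    W = (X [ c ]≔ inside) [ v ]≔ outside
    closed′ : ∀ {y v′} → y ∈ unreachable W b → v′ ∈ U → Adj G y v′ → v′ ∈ unreachable W b ⊎ v′ ≡ v
    closed′ {v′ = v′} y∈Y v′∈U a with v′ ≟ v
    ... | yes v′≡v = inj₂ v′≡v
    ... | no v′≢v  = inj₁ (unreachable-closed W b y∈Y (∈-delete⁺ (closed-rooted br (Y⊆X y∈Y) v′∈U a) v′≢v) a)

  rooted-connected : ∀ {U c X} → ConnectedIn G U → Branch U c X → ConnectedIn G (X [ c ]≔ inside)
  rooted-connected {U} {c} {X} conn br u v u∈S v∈S = reverse (from-root u∈S) ++ᵂ from-root v∈S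
    where
    S : Subset n
    S = X [ c ]≔ inside
    -- Being outside the part of S reachable from c propagates along U-walks, by closedness of the branch.
    from-root : ∀ {s} → s ∈ S → Walk G S c s
    from-root {s} s∈S with walk? S c s
    ... | yes wlk = wlk
    ... | no ¬wlk =
      let (_ , ¬c-c) = transport Unreached stays-unreached (conn s c (rooted⊆U br s∈S) (root∈U br)) (s∈S , ¬wlk)
      in ⊥-elim (¬c-c (here (∈-insert-here X c)))
      where
      Unreached : Fin n → Set
      Unreached y = y ∈ S × ¬ Walk G S c y
      stays-unreached : ∀ {y v} → Unreached y → v ∈ U → Adj G y v → Unreached v
      stays-unreached {y} {v} (y∈S , ¬c-y) v∈U a with ∈-insert⁻ y∈S
      ... | inj₁ refl = ⊥-elim (¬c-y (here (∈-insert-here X c)))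
      ... | inj₂ y∈X  = closed-rooted br y∈X v∈U a , λ c-v → ¬c-y (c-v ▷ (Adj-sym a , y∈S))

  smaller-branch : ∀ {U c X v u w} → Branch U c X →
                   let S = X [ c ]≔ inside in
                   v ∈ S → u ∈ S [ v ]≔ outside → w ∈ S [ v ]≔ outside → ¬ Walk G (S [ v ]≔ outside) u w →
                   Σ (Fin n) λ c′ → Σ (Subset n) λ Y → Branch U c′ Y × Y ⊏ X
  smaller-branch {U} {c} {X} {v} {u} {w} br v∈S u∈W w∈W ¬u-w with v ≟ c
  ... | yes refl = c , Y , sub-branch {b = u} br v∈S (w , ∈-unreachable⁺ W u w∈W ¬u-w) Y⊆X , card-< Y⊆X u∈X u∉Y
    where
    W Y : Subset n
    W = (X [ c ]≔ inside) [ c ]≔ outside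
    Y = unreachable W u
    ∈W⇒∈X : ∀ {y} → y ∈ W → y ∈ X
    ∈W⇒∈X y∈W = let (y∈S , y≢c) = ∈-delete⁻ y∈W in ∈-insert⁻′ y∈S y≢c
    Y⊆X : Y ⊆ X
    Y⊆X = ∈W⇒∈X ∘ proj₁ ∘ ∈-unreachable⁻ W u
    u∈X : u ∈ X
    u∈X = ∈W⇒∈X u∈W
    u∉Y : u ∉ Y
    u∉Y u∈Y = proj₂ (∈-unreachable⁻ W u u∈Y) (here u∈W)
  ... | no v≢c = v , Y , sub-branch {b = c} br v∈S Y≠∅ Y⊆X , card-< Y⊆X (∈-insert⁻′ v∈S v≢c) v∉Y
    where
    W Y : Subset n
    W = (X [ c ]≔ inside) [ v ]≔ outside
    Y = unreachable W c
    c∈W : c ∈ W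
    c∈W = ∈-delete⁺ (∈-insert-here X c) (v≢c ∘ sym)
    Y⊆X : Y ⊆ X
    Y⊆X {y} y∈Y with ∈-unreachable⁻ W c y∈Y
    ... | y∈W , ¬c-y = ∈-insert⁻′ (proj₁ (∈-delete⁻ y∈W)) λ { refl → ¬c-y (here c∈W) }
    Y≠∅ : Nonempty Y
    Y≠∅ with walk? W c u | walk? W c w
    ... | no ¬c-u  | _        = u , ∈-unreachable⁺ W c u∈W ¬c-u
    ... | yes _    | no ¬c-w  = w , ∈-unreachable⁺ W c w∈W ¬c-w
    ... | yes c-u  | yes c-w  = ⊥-elim (¬u-w (reverse c-u ++ᵂ c-w))
    v∉Y : v ∉ Y
    v∉Y v∈Y = proj₂ (∈-delete⁻ (proj₁ (∈-unreachable⁻ W c v∈Y))) refl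

  end-block : ∀ {U c X} → ConnectedIn G U → Branch U c X →
              Σ (Fin n) λ c′ → Σ (Subset n) λ X′ → Branch U c′ X′ × NoCutConnected G (X′ [ c′ ]≔ inside)
  end-block {U} {X = X} conn = go (⊏-wellFounded X)
    where
    go : ∀ {c X} → Acc _⊏_ X → Branch U c X →
         Σ (Fin n) λ c′ → Σ (Subset n) λ X′ → Branch U c′ X′ × NoCutConnected G (X′ [ c′ ]≔ inside)
    go {c} {X} (acc smaller) br
      with all? (λ v → (v ∈? X [ c ]≔ inside) →-dec connected? ((X [ c ]≔ inside) [ v ]≔ outside))
    ... | yes no-cut = c , X , br , (c , ∈-insert-here X c) , rooted-connected conn br , no-cut
    ... | no has-cut =
      let S = X [ c ]≔ inside
          (v , v∈S , ¬conn)         = counterexample (_∈? S) (λ v → connected? (S [ v ]≔ outside)) has-cut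
          (u , w , u∈ , w∈ , ¬u-w)  = disconnected (S [ v ]≔ outside) ¬conn
          (c′ , Y , br′ , Y⊏X)      = smaller-branch br v∈S u∈ w∈ ¬u-w
      in go (smaller Y⊏X) br′

module EdgeForm {n : ℕ} (G : Graph n) where

  infixl 6 _⊕_
  _⊕_ : (Fin n → ℕ) → (Fin n → ℕ) → Fin n → ℕ
  (f ⊕ g) u = f u + g u

  χ : Subset n → Fin n → ℕ
  χ S u = ⟦ lookup S u ⟧

  A : Fin n → Fin n → ℕ
  A u v = ⟦ adj G u v ⟧

  A-sym : ∀ u v → A u v ≡ A v u
  A-sym u v = cong ⟦_⟧ (Graph.sym G u v)

  -- ⟪ χ U , χ U ⟫ = 2 |E(G[U])|
  ⟪_,_⟫ : (Fin n → ℕ) → (Fin n → ℕ) → ℕ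
  ⟪ f , g ⟫ = ∑∑ λ u v → f u * g v * A u v

  ⟪⟫-cong : ∀ {f f′ g g′} → (∀ u → f u ≡ f′ u) → (∀ v → g v ≡ g′ v) → ⟪ f , g ⟫ ≡ ⟪ f′ , g′ ⟫
  ⟪⟫-cong f≗f′ g≗g′ = ∑∑-cong λ u v → cong₂ (λ a b → a * b * A u v) (f≗f′ u) (g≗g′ v)

  ⟪⟫-distribʳ : ∀ f f′ g → ⟪ f ⊕ f′ , g ⟫ ≡ ⟪ f , g ⟫ + ⟪ f′ , g ⟫
  ⟪⟫-distribʳ f f′ g = trans (∑∑-cong λ u v → distrib (f u) (f′ u) (g v) (A u v))
                              (∑∑-distrib-+ (λ u v → f u * g v * A u v) (λ u v → f′ u * g v * A u v))
    where
    distrib : ∀ a b c d → (a + b) * c * d ≡ a * c * d + b * c * d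
    distrib = solve 4 (λ a b c d → (a :+ b) :* c :* d := a :* c :* d :+ b :* c :* d) refl

  ⟪⟫-distribˡ : ∀ f g g′ → ⟪ f , g ⊕ g′ ⟫ ≡ ⟪ f , g ⟫ + ⟪ f , g′ ⟫
  ⟪⟫-distribˡ f g g′ = trans (∑∑-cong λ u v → distrib (f u) (g v) (g′ v) (A u v))
                              (∑∑-distrib-+ (λ u v → f u * g v * A u v) (λ u v → f u * g′ v * A u v))
    where
    distrib : ∀ a b c d → a * (b + c) * d ≡ a * b * d + a * c * d
    distrib = solve 4 (λ a b c d → a :* (b :+ c) :* d := a :* b :* d :+ a :* c :* d) refl

  ⟪⟫-comm : ∀ f g → ⟪ f , g ⟫ ≡ ⟪ g , f ⟫
  ⟪⟫-comm f g = trans (∑-comm (λ u v → f u * g v * A u v)) (∑∑-cong λ v u → swap (f u) (g v) (A-sym u v))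
    where
    swap : ∀ a b {c d} → c ≡ d → a * b * c ≡ b * a * d
    swap a b {c} refl = cong (_* c) (*-comm a b)

  ⟪⟫-expand : ∀ f g → ⟪ f ⊕ g , f ⊕ g ⟫ ≡ ⟪ f , f ⟫ + 2 * ⟪ f , g ⟫ + ⟪ g , g ⟫
  ⟪⟫-expand f g = begin
    ⟪ f ⊕ g , f ⊕ g ⟫
      ≡⟨ ⟪⟫-distribʳ f g (f ⊕ g) ⟩
    ⟪ f , f ⊕ g ⟫ + ⟪ g , f ⊕ g ⟫
      ≡⟨ cong₂ _+_ (⟪⟫-distribˡ f f g) (⟪⟫-distribˡ g f g) ⟩
    ⟪ f , f ⟫ + ⟪ f , g ⟫ + (⟪ g , f ⟫ + ⟪ g , g ⟫)
      ≡⟨ cong (λ x → ⟪ f , f ⟫ + ⟪ f , g ⟫ + (x + ⟪ g , g ⟫)) (⟪⟫-comm g f) ⟩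
    ⟪ f , f ⟫ + ⟪ f , g ⟫ + (⟪ f , g ⟫ + ⟪ g , g ⟫)
      ≡⟨ regroup ⟪ f , f ⟫ ⟪ f , g ⟫ ⟪ g , g ⟫ ⟩
    ⟪ f , f ⟫ + 2 * ⟪ f , g ⟫ + ⟪ g , g ⟫ ∎
    where
    open ≡-Reasoning
    regroup : ∀ a b c → a + b + (b + c) ≡ a + 2 * b + c
    regroup = solve 3 (λ a b c → a :+ b :+ (b :+ c) := a :+ con 2 :* b :+ c) refl

  ⟪⟫-glue : ∀ f e g → ⟪ f , g ⟫ ≡ 0 → ⟪ e , e ⟫ ≡ 0 →
            ⟪ f ⊕ e ⊕ g , f ⊕ e ⊕ g ⟫ ≡ ⟪ f ⊕ e , f ⊕ e ⟫ + ⟪ e ⊕ g , e ⊕ g ⟫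
  ⟪⟫-glue f e g ⟪f,g⟫≡0 ⟪e,e⟫≡0 = begin
    ⟪ f ⊕ e ⊕ g , f ⊕ e ⊕ g ⟫
      ≡⟨ ⟪⟫-expand (f ⊕ e) g ⟩
    ⟪ f ⊕ e , f ⊕ e ⟫ + 2 * ⟪ f ⊕ e , g ⟫ + ⟪ g , g ⟫
      ≡⟨ cong (λ x → ⟪ f ⊕ e , f ⊕ e ⟫ + 2 * x + ⟪ g , g ⟫) ⟪f⊕e,g⟫ ⟩
    ⟪ f ⊕ e , f ⊕ e ⟫ + 2 * ⟪ e , g ⟫ + ⟪ g , g ⟫
      ≡⟨ +-assoc ⟪ f ⊕ e , f ⊕ e ⟫ _ _ ⟩
    ⟪ f ⊕ e , f ⊕ e ⟫ + (2 * ⟪ e , g ⟫ + ⟪ g , g ⟫)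
      ≡⟨ cong (λ x → ⟪ f ⊕ e , f ⊕ e ⟫ + (x + 2 * ⟪ e , g ⟫ + ⟪ g , g ⟫)) ⟪e,e⟫≡0 ⟨
    ⟪ f ⊕ e , f ⊕ e ⟫ + (⟪ e , e ⟫ + 2 * ⟪ e , g ⟫ + ⟪ g , g ⟫)
      ≡⟨ cong (⟪ f ⊕ e , f ⊕ e ⟫ +_) (⟪⟫-expand e g) ⟨
    ⟪ f ⊕ e , f ⊕ e ⟫ + ⟪ e ⊕ g , e ⊕ g ⟫                     ∎
    where
    open ≡-Reasoning
    ⟪f⊕e,g⟫ : ⟪ f ⊕ e , g ⟫ ≡ ⟪ e , g ⟫
    ⟪f⊕e,g⟫ = trans (⟪⟫-distribʳ f e g) (cong (_+ ⟪ e , g ⟫) ⟪f,g⟫≡0)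

  degIn≡∑ : ∀ S u → degIn G S u ≡ ∑[ v < n ] (χ S v * A u v)
  degIn≡∑ S u = trans (countF≡∑ (λ v → adj G u v ∧ lookup S v)) (∑-cong λ v → ⟦∧⟧ (adj G u v) (lookup S v))

  ⟪⟫-χʳ : ∀ f S → ⟪ f , χ S ⟫ ≡ ∑[ u < n ] (f u * degIn G S u)
  ⟪⟫-χʳ f S = ∑-cong λ u → begin
    ∑[ v < n ] (f u * χ S v * A u v)
      ≡⟨ ∑-cong (λ v → *-assoc (f u) (χ S v) (A u v)) ⟩
    ∑[ v < n ] (f u * (χ S v * A u v))
      ≡⟨ *-distribˡ-sum (f u) (λ v → χ S v * A u v) ⟨
    f u * ∑[ v < n ] (χ S v * A u v)
      ≡⟨ cong (f u *_) (degIn≡∑ S u) ⟨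
    f u * degIn G S u                  ∎
    where open ≡-Reasoning

  ⟪δ,χ⟫ : ∀ c S → ⟪ δ c , χ S ⟫ ≡ degIn G S c
  ⟪δ,χ⟫ c S = trans (⟪⟫-χʳ (δ c) S) (∑-δ c (degIn G S))

  ⟪δ,δ⟫ : ∀ c → ⟪ δ c , δ c ⟫ ≡ 0
  ⟪δ,δ⟫ c = ∑∑-zero λ u v → loopless (u ≟ c) (v ≟ c)
    where
    loopless : ∀ {u v} (u≟c : Dec (u ≡ c)) (v≟c : Dec (v ≡ c)) → ⟦ does u≟c ⟧ * ⟦ does v≟c ⟧ * A u v ≡ 0
    loopless (no _)    _         = refl
    loopless (yes _)   (no _)    = refl
    loopless (yes refl) (yes refl) = trans (+-identityʳ (A c c)) (cong ⟦_⟧ (Graph.irrefl G c))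

  ⟪χ,χ⟫-no-edges : ∀ P Q → (∀ {u v} → u ∈ P → v ∈ Q → ¬ Adj G u v) → ⟪ χ P , χ Q ⟫ ≡ 0
  ⟪χ,χ⟫-no-edges P Q no-edge = ∑∑-zero term
    where
    term : ∀ u v → χ P u * χ Q v * A u v ≡ 0
    term u v with lookup P u in u∈P | lookup Q v in v∈Q | adj G u v in u~v
    ... | false | _     | _     = refl
    ... | true  | false | _     = refl
    ... | true  | true  | false = refl
    ... | true  | true  | true  = ⊥-elim (no-edge (lookup⇒∈ u∈P) (lookup⇒∈ v∈Q) (≡true⇒T u~v))

  ⟪χ,χ⟫-≤ : ∀ S S′ b → (∀ {u} → u ∈ S → degIn G S′ u ≤ b) → ⟪ χ S , χ S′ ⟫ ≤ card S * b
  ⟪χ,χ⟫-≤ S S′ b deg≤b = begin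
    ⟪ χ S , χ S′ ⟫
      ≡⟨ ⟪⟫-χʳ (χ S) S′ ⟩
    ∑[ u < n ] (χ S u * degIn G S′ u)
      ≤⟨ ∑-mono-≤ term ⟩
    ∑[ u < n ] (χ S u * b)
      ≡⟨ *-distribʳ-sum b (χ S) ⟨
    ∑[ u < n ] χ S u * b
      ≡⟨ cong (_* b) (countF≡∑ (lookup S)) ⟨
    card S * b                      ∎
    where
    open ≤-Reasoning
    term : ∀ u → χ S u * degIn G S′ u ≤ χ S u * b
    term u with lookup S u in u∈S
    ... | false = z≤n
    ... | true  = *-monoʳ-≤ 1 (deg≤b (lookup⇒∈ u∈S))

  card≡∑χ : ∀ S → card S ≡ ∑[ u < n ] χ S u
  card≡∑χ S = countF≡∑ (lookup S)

  card-⊕ : ∀ {U X R} → (∀ x → χ U x ≡ (χ X ⊕ χ R) x) → card U ≡ card X + card R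
  card-⊕ {U} {X} {R} U≗X⊕R = begin
    card U
      ≡⟨ card≡∑χ U ⟩
    ∑[ x < n ] χ U x
      ≡⟨ ∑-cong U≗X⊕R ⟩
    ∑[ x < n ] (χ X ⊕ χ R) x
      ≡⟨ ∑-distrib-+ (χ X) (χ R) ⟩
    ∑[ x < n ] χ X x + ∑[ x < n ] χ R x
      ≡⟨ cong₂ _+_ (card≡∑χ X) (card≡∑χ R) ⟨
    card X + card R        ∎
    where open ≡-Reasoning

  χ-─ : ∀ {U X} → X ⊆ U → ∀ x → χ U x ≡ (χ X ⊕ χ (U ─ X)) x
  χ-─ {U} {X} X⊆U x with lookup X x in x∈X | lookup U x in x∈U
  ... | true  | true
    rewrite ∉⇒lookup {x = x} {S = U ─ X} (λ x∈U─X → x∈p─q⇒x∉q U X x∈U─X (lookup⇒∈ {S = X} x∈X)) = refl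
  ... | true  | false = ⊥-elim (lookup⇒∉ x∈U (X⊆U (lookup⇒∈ x∈X)))
  ... | false | true
    rewrite ∈⇒lookup (x∈p∧x∉q⇒x∈p─q {q = X} (lookup⇒∈ {S = U} x∈U) (lookup⇒∉ x∈X)) = refl
  ... | false | false rewrite ∉⇒lookup {S = U ─ X} (lookup⇒∉ x∈U ∘ p─q⊆p U X) = refl

  χ-insert : ∀ {X c} → c ∉ X → ∀ x → χ (X [ c ]≔ inside) x ≡ (χ X ⊕ δ c) x
  χ-insert {X} {c} c∉X x with x ≟ c
  ... | yes refl rewrite lookup∘updateAt c {const inside} X | ∉⇒lookup c∉X = refl
  ... | no x≢c   rewrite lookup∘updateAt′ x c {const inside} x≢c X = sym (+-identityʳ _)

  card-insert : ∀ {X c} → c ∉ X → card (X [ c ]≔ inside) ≡ suc (card X)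
  card-insert {X} {c} c∉X = begin
    card (X [ c ]≔ inside)
      ≡⟨ card≡∑χ (X [ c ]≔ inside) ⟩
    ∑[ x < n ] χ (X [ c ]≔ inside) x
      ≡⟨ ∑-cong (χ-insert c∉X) ⟩
    ∑[ x < n ] (χ X ⊕ δ c) x
      ≡⟨ ∑-distrib-+ (χ X) (δ c) ⟩
    ∑[ x < n ] χ X x + ∑[ x < n ] δ c x
      ≡⟨ cong₂ _+_ (sym (card≡∑χ X)) ∑δ≡1 ⟩
    card X + 1
      ≡⟨ +-comm (card X) 1 ⟩
    suc (card X)                         ∎
    where
    open ≡-Reasoning
    ∑δ≡1 : ∑[ x < n ] δ c x ≡ 1
    ∑δ≡1 = trans (∑-cong λ x → sym (*-identityʳ (δ c x))) (∑-δ c (const 1))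

  card-⊤ : card (⊤ {n}) ≡ n
  card-⊤ = trans (card≡∑χ (⊤ {n}))
                 (trans (∑-cong {x = χ ⊤} {y = λ _ → 1} λ u → cong ⟦_⟧ (lookup-replicate u true)) (∑-one n))

  private
    below : Fin n → Fin n → ℕ
    below u v = ⟦ adj G u v ∧ (toℕ u <ᵇ toℕ v) ⟧

    A≡below+below : ∀ u v → A u v ≡ below u v + below v u
    A≡below+below u v with toℕ u <ᵇ toℕ v | <ᵇ-reflects-< (toℕ u) (toℕ v)
                         | toℕ v <ᵇ toℕ u | <ᵇ-reflects-< (toℕ v) (toℕ u)
    ... | true  | ofʸ u<v | true  | ofʸ v<u = ⊥-elim (<-asym u<v v<u)
    ... | true  | _       | false | _       rewrite ∧-identityʳ (adj G u v) | ∧-zeroʳ (adj G v u) = sym (+-identityʳ _)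
    ... | false | _       | true  | _       rewrite ∧-identityʳ (adj G v u) | ∧-zeroʳ (adj G u v) = A-sym u v
    ... | false | ofⁿ u≮v | false | ofⁿ v≮u with toℕ-injective (≤-antisym (≮⇒≥ v≮u) (≮⇒≥ u≮v))
    ...   | refl rewrite Graph.irrefl G u = refl

  handshake : ⟪ χ ⊤ , χ ⊤ ⟫ ≡ 2 * edgeCount G
  handshake = begin
    ⟪ χ ⊤ , χ ⊤ ⟫
      ≡⟨ ∑∑-cong (λ u v → cong₂ (λ a b → a * b * A u v) (χ⊤ u) (χ⊤ v)) ⟩
    ∑∑ (λ u v → 1 * 1 * A u v)
      ≡⟨ ∑∑-cong (λ u v → trans (*-identityˡ (A u v)) (A≡below+below u v)) ⟩
    ∑∑ (λ u v → below u v + below v u)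
      ≡⟨ ∑∑-distrib-+ below (λ u v → below v u) ⟩
    ∑∑ below + ∑∑ (λ u v → below v u)
      ≡⟨ cong (∑∑ below +_) (∑-comm (λ u v → below v u)) ⟩
    ∑∑ below + ∑∑ below
      ≡⟨ cong (λ m → m + m) edges ⟩
    edgeCount G + edgeCount G
      ≡⟨ cong (edgeCount G +_) (+-identityʳ _) ⟨
    2 * edgeCount G                          ∎
    where
    open ≡-Reasoning
    χ⊤ : ∀ u → χ ⊤ u ≡ 1
    χ⊤ u = cong ⟦_⟧ (lookup-replicate u true)
    edges : ∑∑ below ≡ edgeCount G
    edges = sym (trans (sumF≡∑ (λ u → countF (λ v → adj G u v ∧ (toℕ u <ᵇ toℕ v))))
                       (∑-cong λ u → countF≡∑ (λ v → adj G u v ∧ (toℕ u <ᵇ toℕ v))))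

-- Throughout, k = 4 + j.
module Density (j : ℕ) where

  K : ℕ
  K = 3 + j

  C : ℕ
  C = (2 + j) * K + 2

  private
    ≤-from-+ : ∀ {a b} c → a + c ≡ b → a ≤ b
    ≤-from-+ {a} c refl = m≤m+n a c

  -- Admissible (2|E|) |V| is the inequality of the theorem.
  record Admissible (a p : ℕ) : Set where
    constructor admissible
    field bound : a * K ≤ C * p

  combine : ∀ {a b p q} → Admissible a p → Admissible b q → Admissible (a + b) (p + q)
  combine {a} {b} {p} {q} (admissible a≤) (admissible b≤) = admissible (begin
    (a + b) * K
      ≡⟨ *-distribʳ-+ K a b ⟩
    a * K + b * K
      ≤⟨ +-mono-≤ a≤ b≤ ⟩
    C * p + C * q
      ≡⟨ *-distribˡ-+ C p q ⟨
    C * (p + q)     ∎)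
    where open ≤-Reasoning

  small-piece : ∀ {m x} → m ≤ suc j → x ≤ suc m * m → Admissible x m
  small-piece {m} {x} m≤ x≤ = admissible (begin
    x * K
      ≤⟨ *-monoˡ-≤ K (≤-trans x≤ (*-monoˡ-≤ m (s≤s m≤))) ⟩
    (2 + j) * m * K       ≤⟨ ≤-from-+ (2 * m) (solve 2 (λ j m → (con 2 :+ j) :* m :* (con 3 :+ j) :+ con 2 :* m
                                                     := ((con 2 :+ j) :* (con 3 :+ j) :+ con 2) :* m) refl j m) ⟩
    C * m                 ∎)
    where open ≤-Reasoning

  cycle-piece : ∀ {m x} → 3 ≤ m → x ≤ suc m * 2 → Admissible x m
  cycle-piece {x = x} (s≤s (s≤s (s≤s {n = t} z≤n))) x≤ = admissible (begin
    x * K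
      ≤⟨ *-monoˡ-≤ K x≤ ⟩
    (4 + t) * 2 * K       ≤⟨ ≤-from-+ (3 * j * j + 7 * j + t * (j * j + 3 * j + 2))
                               (solve 2 (λ j t → (con 4 :+ t) :* con 2 :* (con 3 :+ j)
                                                   :+ (con 3 :* j :* j :+ con 7 :* j :+ t :* (j :* j :+ con 3 :* j :+ con 2))
                                                 := ((con 2 :+ j) :* (con 3 :+ j) :+ con 2) :* (con 3 :+ t)) refl j t) ⟩
    C * (3 + t)           ∎)
    where open ≤-Reasoning

  -- r ≥ k − 2 forces d ≤ 1, since r + d is at most the degree bound K.
  heavy-piece : ∀ {r d s} → 2 + j ≤ r → r + d ≤ K → s ≤ (2 + j) * (2 + j) + r → s + 2 * d ≤ C
  heavy-piece {r} {d} {s} 2+j≤r r+d≤K s≤ = begin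
    s + 2 * d
      ≤⟨ +-monoˡ-≤ (2 * d) s≤ ⟩
    (2 + j) * (2 + j) + r + 2 * d
      ≡⟨ solve 4 (λ j r d e → e :+ r :+ con 2 :* d := e :+ ((r :+ d) :+ d)) refl j r d ((2 + j) * (2 + j)) ⟩
    (2 + j) * (2 + j) + ((r + d) + d)
      ≤⟨ +-monoʳ-≤ ((2 + j) * (2 + j)) (+-mono-≤ r+d≤K d≤1) ⟩
    (2 + j) * (2 + j) + (K + 1)            ≡⟨ solve 1 (λ j → (con 2 :+ j) :* (con 2 :+ j) :+ ((con 3 :+ j) :+ con 1)
                                                   := (con 2 :+ j) :* (con 3 :+ j) :+ con 2) refl j ⟩
    C                                      ∎
    where
    open ≤-Reasoning
    d≤1 : d ≤ 1
    d≤1 = +-cancelˡ-≤ (2 + j) d 1 (≤-trans (+-monoˡ-≤ d 2+j≤r) (≤-trans r+d≤K (≤-reflexive (sym (+-comm (2 + j) 1)))))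

module Sparsity (j : ℕ) {n : ℕ} (G : Graph n) (gdp : IsGDPTree G)
                (deg≤K : ∀ v → deg G v ≤ 3 + j) (noK : ¬ ContainsK (4 + j) G) where
  open Walks G
  open Degrees G
  open Blocks G
  open Branches G
  open Branch
  open EdgeForm G
  open Density j

  Sparse : Subset n → Set
  Sparse U = Admissible ⟪ χ U , χ U ⟫ (card U)

  sparse-parts : ∀ U {a b p q} → ⟪ χ U , χ U ⟫ ≡ a + b → card U ≡ p + q →
                 Admissible a p → Admissible b q → Sparse U
  sparse-parts U ⟪U⟫≡ card≡ a-ok b-ok = subst₂ Admissible (sym ⟪U⟫≡) (sym card≡) (combine a-ok b-ok)

  sparse-tiny : ∀ {U} → card U ≤ 1 → Sparse U
  sparse-tiny {U} U≤1 = subst (λ x → Admissible x (card U)) (sym ⟪U⟫≡0) (admissible z≤n)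
    where
    ⟪U⟫≡0 : ⟪ χ U , χ U ⟫ ≡ 0
    ⟪U⟫≡0 = n≤0⇒n≡0 (≤-trans (⟪χ,χ⟫-≤ U U 0 λ u∈U → ≤-pred (≤-trans (degIn-< {U} u∈U) U≤1))
                             (≤-reflexive (*-zeroʳ (card U))))

  sparse-disconnected : ∀ {U u w} → u ∈ U → w ∈ U → ¬ Walk G U u w →
                        (∀ V → V ⊏ U → Sparse V) → Sparse U
  sparse-disconnected {U} {u} {w} u∈U w∈U ¬u-w ih =
    sparse-parts U ⟪U⟫≡ (card-⊕ {U} {Y} {R} U≗Y⊕R) (ih Y Y⊏U) (ih R R⊏U)
    where
    Y R : Subset n
    Y = unreachable U u
    R = U ─ Y
    Y⊆U : Y ⊆ U
    Y⊆U = proj₁ ∘ ∈-unreachable⁻ U u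
    U≗Y⊕R : ∀ x → χ U x ≡ (χ Y ⊕ χ R) x
    U≗Y⊕R = χ-─ Y⊆U
    Y⊏U : Y ⊏ U
    Y⊏U = card-< Y⊆U u∈U λ u∈Y → proj₂ (∈-unreachable⁻ U u u∈Y) (here u∈U)
    R⊏U : R ⊏ U
    R⊏U = card-< (p─q⊆p U Y) w∈U λ w∈R → x∈p─q⇒x∉q U Y w∈R (∈-unreachable⁺ U u w∈U ¬u-w)
    ⟪Y,R⟫≡0 : ⟪ χ Y , χ R ⟫ ≡ 0
    ⟪Y,R⟫≡0 = ⟪χ,χ⟫-no-edges Y R λ y∈Y v∈R y~v →
      x∈p─q⇒x∉q U Y v∈R (unreachable-closed U u y∈Y (p─q⊆p U Y v∈R) y~v)
    ⟪U⟫≡ : ⟪ χ U , χ U ⟫ ≡ ⟪ χ Y , χ Y ⟫ + ⟪ χ R , χ R ⟫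
    ⟪U⟫≡ = begin
      ⟪ χ U , χ U ⟫
        ≡⟨ ⟪⟫-cong U≗Y⊕R U≗Y⊕R ⟩
      ⟪ χ Y ⊕ χ R , χ Y ⊕ χ R ⟫
        ≡⟨ ⟪⟫-expand (χ Y) (χ R) ⟩
      ⟪ χ Y , χ Y ⟫ + 2 * ⟪ χ Y , χ R ⟫ + ⟪ χ R , χ R ⟫
        ≡⟨ cong (λ x → ⟪ χ Y , χ Y ⟫ + 2 * x + ⟪ χ R , χ R ⟫) ⟪Y,R⟫≡0 ⟩
      ⟪ χ Y , χ Y ⟫ + 0 + ⟪ χ R , χ R ⟫
        ≡⟨ cong (_+ ⟪ χ R , χ R ⟫) (+-identityʳ _) ⟩
      ⟪ χ Y , χ Y ⟫ + ⟪ χ R , χ R ⟫                            ∎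
      where open ≡-Reasoning

  module EndBlock {U c X} (br : Branch U c X) (ncc : NoCutConnected G (X [ c ]≔ inside))
                  (ih : ∀ V → V ⊏ U → Sparse V) where
    S R R′ : Subset n
    S  = X [ c ]≔ inside
    R  = U ─ X
    R′ = U ─ S

    c∈S : c ∈ S
    c∈S = ∈-insert-here X c

    card-S : card S ≡ suc (card X)
    card-S = card-insert (root∉X br)

    S≗X⊕c : ∀ x → χ S x ≡ (χ X ⊕ δ c) x
    S≗X⊕c = χ-insert (root∉X br)

    U≗X⊕R : ∀ x → χ U x ≡ (χ X ⊕ χ R) x
    U≗X⊕R = χ-─ (X⊆U br)

    U≗S⊕R′ : ∀ x → χ U x ≡ (χ S ⊕ χ R′) x
    U≗S⊕R′ = χ-─ (rooted⊆U br)

    U≗X⊕c⊕R′ : ∀ x → χ U x ≡ (χ X ⊕ δ c ⊕ χ R′) x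
    U≗X⊕c⊕R′ x = trans (U≗S⊕R′ x) (cong (_+ χ R′ x) (S≗X⊕c x))

    R≗c⊕R′ : ∀ x → χ R x ≡ (δ c ⊕ χ R′) x
    R≗c⊕R′ x = +-cancelˡ-≡ (χ X x) _ _ (trans (sym (U≗X⊕R x)) (trans (U≗X⊕c⊕R′ x) (+-assoc (χ X x) _ _)))

    ⟪X,R′⟫≡0 : ⟪ χ X , χ R′ ⟫ ≡ 0
    ⟪X,R′⟫≡0 = ⟪χ,χ⟫-no-edges X R′ λ x∈X v∈R′ x~v →
      x∈p─q⇒x∉q U S v∈R′ (closed-rooted br x∈X (p─q⊆p U S v∈R′) x~v)

    degIn-S≤X : ∀ {u} → u ∈ S → degIn G S u ≤ card X
    degIn-S≤X u∈S = ≤-pred (subst (degIn G S _ <_) card-S (degIn-< u∈S))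

    R⊏U : R ⊏ U
    R⊏U = let (x , x∈X) = nonempty br in
          card-< (p─q⊆p U X) (X⊆U br x∈X) λ x∈R → x∈p─q⇒x∉q U X x∈R x∈X

    R′⊏U : R′ ⊏ U
    R′⊏U = card-< (p─q⊆p U S) (root∈U br) λ c∈R′ → x∈p─q⇒x∉q U S c∈R′ c∈S

    ⟪U⟫≡S+R : ⟪ χ U , χ U ⟫ ≡ ⟪ χ S , χ S ⟫ + ⟪ χ R , χ R ⟫
    ⟪U⟫≡S+R = begin
      ⟪ χ U , χ U ⟫
        ≡⟨ ⟪⟫-cong U≗X⊕c⊕R′ U≗X⊕c⊕R′ ⟩
      ⟪ χ X ⊕ δ c ⊕ χ R′ , χ X ⊕ δ c ⊕ χ R′ ⟫
        ≡⟨ ⟪⟫-glue (χ X) (δ c) (χ R′) ⟪X,R′⟫≡0 (⟪δ,δ⟫ c) ⟩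
      ⟪ χ X ⊕ δ c , χ X ⊕ δ c ⟫ + ⟪ δ c ⊕ χ R′ , δ c ⊕ χ R′ ⟫
        ≡⟨ cong₂ _+_ (⟪⟫-cong S≗X⊕c S≗X⊕c) (⟪⟫-cong R≗c⊕R′ R≗c⊕R′) ⟨
      ⟪ χ S , χ S ⟫ + ⟪ χ R , χ R ⟫                                 ∎
      where open ≡-Reasoning

    ⟪S,R′⟫≡degIn : ⟪ χ S , χ R′ ⟫ ≡ degIn G R′ c
    ⟪S,R′⟫≡degIn = begin
      ⟪ χ S , χ R′ ⟫
        ≡⟨ ⟪⟫-cong S≗X⊕c (λ _ → refl) ⟩
      ⟪ χ X ⊕ δ c , χ R′ ⟫
        ≡⟨ ⟪⟫-distribʳ (χ X) (δ c) (χ R′) ⟩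
      ⟪ χ X , χ R′ ⟫ + ⟪ δ c , χ R′ ⟫
        ≡⟨ cong₂ _+_ ⟪X,R′⟫≡0 (⟪δ,χ⟫ c R′) ⟩
      degIn G R′ c                         ∎
      where open ≡-Reasoning

    ⟪U⟫≡S+2d+R′ : ⟪ χ U , χ U ⟫ ≡ (⟪ χ S , χ S ⟫ + 2 * degIn G R′ c) + ⟪ χ R′ , χ R′ ⟫
    ⟪U⟫≡S+2d+R′ = trans (⟪⟫-cong U≗S⊕R′ U≗S⊕R′) (trans (⟪⟫-expand (χ S) (χ R′))
                    (cong (λ x → ⟪ χ S , χ S ⟫ + 2 * x + ⟪ χ R′ , χ R′ ⟫) ⟪S,R′⟫≡degIn))

    root-degrees : degIn G S c + degIn G R′ c ≤ K
    root-degrees = begin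
      degIn G S c + degIn G R′ c
        ≡⟨ cong₂ _+_ (⟪δ,χ⟫ c S) (⟪δ,χ⟫ c R′) ⟨
      ⟪ δ c , χ S ⟫ + ⟪ δ c , χ R′ ⟫
        ≡⟨ ⟪⟫-distribˡ (δ c) (χ S) (χ R′) ⟨
      ⟪ δ c , χ S ⊕ χ R′ ⟫
        ≡⟨ ⟪⟫-cong {f = δ c} (λ _ → refl) U≗S⊕R′ ⟨
      ⟪ δ c , χ U ⟫
        ≡⟨ ⟪δ,χ⟫ c U ⟩
      degIn G U c
        ≤⟨ degIn-≤-deg U c ⟩
      deg G c
        ≤⟨ deg≤K c ⟩
      K                                    ∎
      where open ≤-Reasoning

    ⟪S⟫≤ : ⟪ χ S , χ S ⟫ ≤ card X * card X + degIn G S c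
    ⟪S⟫≤ = begin
      ⟪ χ S , χ S ⟫
        ≡⟨ ⟪⟫-cong S≗X⊕c (λ _ → refl) ⟩
      ⟪ χ X ⊕ δ c , χ S ⟫
        ≡⟨ ⟪⟫-distribʳ (χ X) (δ c) (χ S) ⟩
      ⟪ χ X , χ S ⟫ + ⟪ δ c , χ S ⟫
        ≤⟨ +-mono-≤ (⟪χ,χ⟫-≤ X S (card X) (degIn-S≤X ∘ ∈-insert⁺)) (≤-reflexive (⟪δ,χ⟫ c S)) ⟩
      card X * card X + degIn G S c        ∎
      where open ≤-Reasoning

    glued : Admissible ⟪ χ S , χ S ⟫ (card X) → Sparse U
    glued S-ok = sparse-parts U ⟪U⟫≡S+R (card-⊕ {U} {X} {R} U≗X⊕R) S-ok (ih R R⊏U)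

    -- Here S has K vertices and its root c is joined to R′ = U ∖ S by at most one edge.
    pendant : card X ≡ 2 + j → 2 + j ≤ degIn G S c → Sparse U
    pendant X≡2+j 2+j≤r = sparse-parts U ⟪U⟫≡S+2d+R′ card-U (admissible (*-monoˡ-≤ K S+2d≤C)) (ih R′ R′⊏U)
      where
      card-U : card U ≡ K + card R′
      card-U = trans (card-⊕ {U} {S} {R′} U≗S⊕R′) (cong (_+ card R′) (trans card-S (cong suc X≡2+j)))
      S+2d≤C : ⟪ χ S , χ S ⟫ + 2 * degIn G R′ c ≤ C
      S+2d≤C = heavy-piece 2+j≤r root-degrees (subst (λ m → ⟪ χ S , χ S ⟫ ≤ m * m + degIn G S c) X≡2+j ⟪S⟫≤)

    sparse-end-block : Sparse U
    sparse-end-block with card X ≤? suc j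
    ... | yes X≤1+j =
      glued (small-piece X≤1+j (subst (λ m → ⟪ χ S , χ S ⟫ ≤ m * card X) card-S (⟪χ,χ⟫-≤ S S (card X) degIn-S≤X)))
    ... | no X≰1+j with gdp-shape gdp S ncc
    ...   | inj₁ complete = pendant (≤-antisym X≤2+j 2+j≤X) (≤-trans 2+j≤X X≤r)
      where
      2+j≤X : 2 + j ≤ card X
      2+j≤X = ≰⇒> X≰1+j
      X≤2+j : card X ≤ 2 + j
      X≤2+j = ≤-pred (subst (_≤ 3 + j) card-S (≤-pred (clique-card noK complete)))
      X≤r : card X ≤ degIn G S c
      X≤r = ≤-pred (subst (_≤ suc (degIn G S c)) card-S (card-≤-suc-degIn complete c∈S))
    ...   | inj₂ (B , S⊆B , cycle) with 3 ≤? card X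
    ...     | yes 3≤X =
      glued (cycle-piece 3≤X (subst (λ m → ⟪ χ S , χ S ⟫ ≤ m * 2) card-S (⟪χ,χ⟫-≤ S S 2 (degIn-cycle S⊆B cycle))))
    ...     | no 3≰X  =
      pendant (≤-antisym (≤-trans X≤2 (m≤m+n 2 j)) 2+j≤X) (≤-trans (≤-trans 2+j≤X X≤2) (noCut-degIn-≥2 ncc 3≤S c∈S))
      where
      2+j≤X : 2 + j ≤ card X
      2+j≤X = ≰⇒> X≰1+j
      X≤2 : card X ≤ 2
      X≤2 = ≤-pred (≰⇒> 3≰X)
      3≤S : 3 ≤ card S
      3≤S = subst (3 ≤_) (sym card-S) (s≤s (≤-trans (m≤m+n 2 j) 2+j≤X))

  open EndBlock using (sparse-end-block)

  sparse-step : ∀ U → (∀ V → V ⊏ U → Sparse V) → Sparse U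
  sparse-step U ih with 2 ≤? card U
  ... | no 2≰U = sparse-tiny {U} (≤-pred (≰⇒> 2≰U))
  ... | yes 2≤U with connected? U
  ...   | no ¬conn =
    let (u , w , u∈U , w∈U , ¬u-w) = disconnected U ¬conn in sparse-disconnected u∈U w∈U ¬u-w ih
  ...   | yes conn =
    let (pick , pick-inj , pick∈U) = countF-injection 2 (lookup U) 2≤U
        c∈U = lookup⇒∈ (pick∈U zero)
        x∈U = lookup⇒∈ (pick∈U (suc zero))
        (c , X , br , ncc) = end-block conn (complement-branch c∈U x∈U λ x≡c → 1≢0 (pick-inj x≡c))
    in sparse-end-block br ncc ih
    where
    1≢0 : Fin.suc {1} zero ≢ zero
    1≢0 ()

  sparse : ∀ U → Sparse U
  sparse = All.wfRec ⊏-wellFounded 0ℓ Sparse λ U ih → sparse-step U λ V → ih {V}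

lemma12 : (k n : ℕ) (T : Graph n) → 4 ≤ k → IsGDPTree T →
          (∀ v → deg T v ≤ k ∸ 1) → ¬ ContainsK k T →
          2 * edgeCount T * (k ∸ 1) ≤ ((k ∸ 2) * (k ∸ 1) + 2) * n
lemma12 .(4 + j) n T (s≤s (s≤s (s≤s (s≤s {n = j} z≤n)))) gdp deg≤ noK =
  subst₂ (λ e m → e * K ≤ C * m) handshake card-⊤ (Admissible.bound (sparse ⊤))
  where
  open EdgeForm T
  open Density j
  open Sparsity j T gdp deg≤ noK
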